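{- For every rational scalar $0<q\le 1$, every value $V$, every intersection type $\mathcal{M}$ and every $v\in\mathbb{Q}$: $\vdash^{qv}V:q\cdot\mathcal{M}$ is derivable (with empty context) if and only if $\vdash^{v}V:\mathcal{M}$ is derivable.
   Context: Terms: values $V ::= x \mid \lambda x.M$; terms $M ::= V \mid VV \mid M\oplus M \mid \mathtt{let}\ x = M\ \mathtt{in}\ M$. Types: arrow types $\mathtt{A} ::= \mathcal{M}\to \mathtt{a}$; intersection types $\mathcal{M} ::= [q_1\cdot \mathtt{A}_1,\dots,q_n\cdot\mathtt{A}_n]$ ($n\ge 0$), a finite multiset of pairs with scale factors $q_i\in(0,1]\cap\mathbb{Q}$; type distributions $\mathtt{a} ::= \langle p_1\mathcal{M}_1,\dots,p_n\mathcal{M}_n\rangle$ ($n\ge0$, $p_i\in(0,1]$, $\sum_i p_i\le 1$). $\mathbf{0}$ is the empty type distribution. For a scalar $u$, $u\cdot[q_i\cdot\mathtt{A}_i]_i=[(uq_i)\cdot \mathtt{A}_i]_i$ and $u\cdot\langle p_i\mathcal{M}_i\rangle_i=\langle (up_i)\mathcal{M}_i\rangle_i$; $\uplus$, $\sqcup$ are multiset unions. Typing contexts map variables to intersection types (finitely many nonempty), with pointwise $\uplus$ and scaling $q\cdot\Gamma$. Judgements $\Gamma\vdash^{w} M:\tau$ ($w\in\mathbb{Q}$) are derived by: (Var) $x:\mathcal{M}\vdash^0 x:\mathcal{M}$. (Zero) $\vdash^0 M:\mathbf{0}$. (@) from $\Gamma\vdash^{w}V:[1\cdot(\mathcal{M}\to\mathtt{b})]$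 and $\Delta\vdash^{v}W:\mathcal{M}$ infer $\Gamma\uplus\Delta\vdash^{w+v}VW:\mathtt{b}$. ($\oplus$) from $\Gamma\vdash^{w}M:\mathtt{a}$, $\Delta\vdash^{v}N:\mathtt{b}$ infer $\tfrac12\cdot\Gamma\uplus\tfrac12\cdot\Delta\vdash^{\frac12 w+\frac12 v+1}M\oplus N:\tfrac12\mathtt{a}\sqcup\tfrac12\mathtt{b}$. ($\lambda$) from $\Gamma,x:\mathcal{M}\vdash^{w}M:\mathtt{b}$ infer $\Gamma\vdash^{w+1}\lambda x.M:\mathcal{M}\to\mathtt{b}$. (let) from $\Gamma\vdash^{v}N:\langle p_k\mathcal{M}_k\rangle_{k\in K}$ and $\Delta_k,x:\mathcal{M}_k\vdash^{w_k}M:\mathtt{b}_k$ ($k\in K$) infer $\Gamma\uplus_{k}p_k\cdot\Delta_k\vdash^{\sum_k p_kw_k+v+1}\mathtt{let}\ x=N\ \mathtt{in}\ M:\bigsqcup_k p_k\mathtt{b}_k$. (Val) from $\Gamma\vdash^{w}V:\mathcal{M}$ infer $\Gamma\vdash^{w}V:\langle 1\mathcal{M}\rangle$. (!) for finite possibly empty $I$, from $\Gamma_i\vdash^{w_i}V:\mathtt{A}_i$ and scale factors $q_i$ infer $\uplus_i q_i\cdot\Gamma_i\vdash^{\sum_i q_iw_i}V:[q_i\cdot\mathtt{A}_i]_{i\in I}$. -}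

module Defs where

open import Data.Nat using (ℕ; _≡ᵇ_)
open import Data.Bool using (if_then_else_)
open import Data.Rational using (ℚ; 0ℚ; 1ℚ; ½; _+_; _*_; _<_; _≤_)
open import Data.List using (List; []; _∷_; map; _++_)
open import Data.Product using (_×_; _,_; proj₁; proj₂)
open import Data.List.Relation.Binary.Permutation.Propositional using (_↭_)
open import Relation.Binary.PropositionalEquality using (_≡_)

Var : Set
Var = ℕ

mutual
  data Value : Set where
    var : Var → Value
    ƛ   : Var → Term → Value

  data Term : Set where
    val  : Value → Term
    _·_  : Value → Value → Term
    _⊕_  : Term → Term → Term
    lett : Var → Term → Term → Term   -- lett x N M  =  let x = N in M

-- Types.  Finite multisets are represented by lists; multiset equality
-- is recovered via the (deep) equivalence _≈A_/_≈I_/_≈D_ below together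
-- with a conversion rule in the type system.

data Arrow : Set where
  _⇒_ : List (ℚ × Arrow) → List (ℚ × List (ℚ × Arrow)) → Arrow

IType : Set           -- intersection types  [q₁·A₁,…,qₙ·Aₙ]
IType = List (ℚ × Arrow)

TDist : Set           -- type distributions  ⟨p₁M₁,…,pₙMₙ⟩
TDist = List (ℚ × IType)

𝟎 : TDist
𝟎 = []

_·I_ : ℚ → IType → IType
u ·I M = map (λ e → (u * proj₁ e , proj₂ e)) M

_·D_ : ℚ → TDist → TDist
u ·D a = map (λ e → (u * proj₁ e , proj₂ e)) a

mass : TDist → ℚ
mass []            = 0ℚ
mass ((p , _) ∷ a) = p + mass a

mutual
  data WFA : Arrow → Set where
    wf⇒ : ∀ {M a} → WFI M → WFD a → WFA (M ⇒ a)

  data WFI : IType → Set where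
    wfI[] : WFI []
    wfI∷  : ∀ {q A M} → 0ℚ < q → q ≤ 1ℚ → WFA A → WFI M → WFI ((q , A) ∷ M)

  data WFD* : TDist → Set where
    wfD[] : WFD* []
    wfD∷  : ∀ {p M a} → 0ℚ < p → p ≤ 1ℚ → WFI M → WFD* a → WFD* ((p , M) ∷ a)

  data WFD : TDist → Set where
    wfD : ∀ {a} → WFD* a → mass a ≤ 1ℚ → WFD a

mutual
  data _≈A_ : Arrow → Arrow → Set where
    ≈⇒ : ∀ {M M' a a'} → M ≈I M' → a ≈D a' → (M ⇒ a) ≈A (M' ⇒ a')

  data _≈I*_ : IType → IType → Set where
    []  : [] ≈I* []
    _∷_ : ∀ {q A A' M M'} → A ≈A A' → M ≈I* M' → ((q , A) ∷ M) ≈I* ((q , A') ∷ M')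

  data _≈I_ : IType → IType → Set where
    ≈I-intro : ∀ {M L N} → M ↭ L → L ≈I* N → M ≈I N

  data _≈D*_ : TDist → TDist → Set where
    []  : [] ≈D* []
    _∷_ : ∀ {p M M' a a'} → M ≈I M' → a ≈D* a' → ((p , M) ∷ a) ≈D* ((p , M') ∷ a')

  data _≈D_ : TDist → TDist → Set where
    ≈D-intro : ∀ {a L b} → a ↭ L → L ≈D* b → a ≈D b

-- Typing contexts: total maps from variables to intersection types
-- (the empty intersection type [] meaning "not in the domain").

Ctx : Set
Ctx = Var → IType

∅ : Ctx
∅ _ = []

_⊎_ : Ctx → Ctx → Ctx
(Γ ⊎ Δ) y = Γ y ++ Δ y

_·C_ : ℚ → Ctx → Ctx
(u ·C Γ) y = u ·I Γ y

_[_↦_] : Ctx → Var → IType → Ctx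
(Γ [ x ↦ M ]) y = if x ≡ᵇ y then M else Γ y

⟪_∶_⟫ : Var → IType → Ctx
⟪ x ∶ M ⟫ = ∅ [ x ↦ M ]

_≈C_ : Ctx → Ctx → Set
Γ ≈C Δ = ∀ y → Γ y ≈I Δ y

-- The type system.
--   Γ ⊢A[ w ] V ∶ A   (value, arrow type)
--   Γ ⊢I[ w ] V ∶ M   (value, intersection type)
--   Γ ⊢D[ w ] M ∶ a   (term, type distribution)
-- A context "Γ , x : M" in a premise is rendered as a context Γ' with
-- Γ' x = M, the conclusion using Γ' [ x ↦ [] ].

mutual
  data _⊢A[_]_∶_ : Ctx → ℚ → Value → Arrow → Set where
    ⊢λ : ∀ {Γ w x M b} →
         Γ ⊢D[ w ] M ∶ b →
         (Γ [ x ↦ [] ]) ⊢A[ w + 1ℚ ] ƛ x M ∶ (Γ x ⇒ b)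
    convA : ∀ {Γ Γ' w V A A'} →
         Γ ⊢A[ w ] V ∶ A → Γ ≈C Γ' → A ≈A A' → Γ' ⊢A[ w ] V ∶ A'

  -- premises of the (!) rule, as a list
  data Bang : Ctx → ℚ → Value → IType → Set where
    bang[] : ∀ {V} → Bang ∅ 0ℚ V []
    bang∷  : ∀ {Γ Δ w u V q A M} →
             0ℚ < q → q ≤ 1ℚ →
             Γ ⊢A[ w ] V ∶ A → Bang Δ u V M →
             Bang ((q ·C Γ) ⊎ Δ) (q * w + u) V ((q , A) ∷ M)

  data _⊢I[_]_∶_ : Ctx → ℚ → Value → IType → Set where
    ⊢var : ∀ {x M} → WFI M → ⟪ x ∶ M ⟫ ⊢I[ 0ℚ ] var x ∶ M
    ⊢!   : ∀ {Γ w V M} → Bang Γ w V M → Γ ⊢I[ w ] V ∶ M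
    convI : ∀ {Γ Γ' w V M M'} →
         Γ ⊢I[ w ] V ∶ M → Γ ≈C Γ' → M ≈I M' → Γ' ⊢I[ w ] V ∶ M'

  -- premises of the (let) rule, as a list indexed by the distribution of N
  data LetBr (x : Var) (M : Term) : TDist → Ctx → ℚ → TDist → Set where
    let[] : LetBr x M [] ∅ 0ℚ 𝟎
    let∷  : ∀ {Δ w b a Δ' w' b' p} →
            Δ ⊢D[ w ] M ∶ b → LetBr x M a Δ' w' b' →
            LetBr x M ((p , Δ x) ∷ a)
                  ((p ·C (Δ [ x ↦ [] ])) ⊎ Δ') (p * w + w') ((p ·D b) ++ b')

  data _⊢D[_]_∶_ : Ctx → ℚ → Term → TDist → Set where
    ⊢zero : ∀ {M} → ∅ ⊢D[ 0ℚ ] M ∶ 𝟎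
    ⊢app   : ∀ {Γ Δ w v V W M b} →
            Γ ⊢I[ w ] V ∶ ((1ℚ , (M ⇒ b)) ∷ []) → Δ ⊢I[ v ] W ∶ M →
            (Γ ⊎ Δ) ⊢D[ w + v ] (V · W) ∶ b
    ⊢⊕    : ∀ {Γ Δ w v M N a b} →
            Γ ⊢D[ w ] M ∶ a → Δ ⊢D[ v ] N ∶ b →
            ((½ ·C Γ) ⊎ (½ ·C Δ)) ⊢D[ ½ * w + ½ * v + 1ℚ ] (M ⊕ N) ∶ ((½ ·D a) ++ (½ ·D b))
    ⊢let  : ∀ {Γ Δ v w x N M a b} →
            Γ ⊢D[ v ] N ∶ a → LetBr x M a Δ w b →
            (Γ ⊎ Δ) ⊢D[ w + v + 1ℚ ] lett x N M ∶ b
    ⊢val  : ∀ {Γ w V M} → Γ ⊢I[ w ] V ∶ M → Γ ⊢D[ w ] val V ∶ ((1ℚ , M) ∷ [])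
    convD : ∀ {Γ Γ' w M a a'} →
         Γ ⊢D[ w ] M ∶ a → Γ ≈C Γ' → a ≈D a' → Γ' ⊢D[ w ] M ∶ a'

Derivable : Ctx → ℚ → Value → IType → Set
Derivable Γ w V M = Γ ⊢I[ w ] V ∶ M

-- Rescaling by u > 0 only touches the scale factors inside (!) rules: every
-- (!) premise q·A becomes (u q)·A, so derivations of V : M in context Γ with
-- weight w become derivations of V : u·M in context u·Γ with weight u w,
-- provided all u q stay at most 1. Scaling by q gives one direction; scaling
-- back by 1/q, which is allowed because M is well formed, gives the other.
module Submission where

open import Defs
open import Data.Bool using (true; false)
open import Data.List using ([]; _∷_; _++_)
open import Data.List.Properties using (map-++)
open import Data.List.Relation.Unary.All using (All; []; _∷_)
open import Data.List.Relation.Binary.Permutation.Propositional using (↭-refl; ↭-sym)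
open import Data.List.Relation.Binary.Permutation.Propositional.Properties using (All-resp-↭; map⁺)
open import Data.Nat using (_≡ᵇ_)
open import Data.Product using (Σ; _×_; _,_; proj₁)
open import Data.Rational using (ℚ; 0ℚ; 1ℚ; _+_; _*_; _<_; _≤_; 1/_; NonZero; positive; nonNegative)
open import Data.Rational.Properties
  using (*-assoc; *-identityˡ; *-identityʳ; *-zeroʳ; *-distribˡ-+; *-inverseˡ; *-monoˡ-≤-nonNeg;
         ≤-trans; <⇒≤; pos*pos⇒pos; 1/pos⇒pos; positive⁻¹; pos⇒nonZero)
open import Function.Bundles using (_⇔_; mk⇔)
open import Relation.Binary.PropositionalEquality using (_≡_; _≗_; refl; sym; trans; cong; cong₂; subst; subst₂; module ≡-Reasoning)
open ≡-Reasoning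

*-pos : ∀ {p q} → 0ℚ < p → 0ℚ < q → 0ℚ < p * q
*-pos {p} {q} 0<p 0<q = positive⁻¹ (p * q) {{pos*pos⇒pos p {{positive 0<p}} q {{positive 0<q}}}}

mutual
  ≈A-refl : ∀ A → A ≈A A
  ≈A-refl (M ⇒ a) = ≈⇒ (≈I-refl M) (≈D-refl a)

  ≈I*-refl : ∀ M → M ≈I* M
  ≈I*-refl []            = []
  ≈I*-refl ((_ , A) ∷ M) = ≈A-refl A ∷ ≈I*-refl M

  ≈I-refl : ∀ M → M ≈I M
  ≈I-refl M = ≈I-intro ↭-refl (≈I*-refl M)

  ≈D*-refl : ∀ a → a ≈D* a
  ≈D*-refl []            = []
  ≈D*-refl ((_ , M) ∷ a) = ≈I-refl M ∷ ≈D*-refl a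

  ≈D-refl : ∀ a → a ≈D a
  ≈D-refl a = ≈D-intro ↭-refl (≈D*-refl a)

≡⇒≈I : ∀ {M N} → M ≡ N → M ≈I N
≡⇒≈I {M} refl = ≈I-refl M

·I-assoc : ∀ u q M → (u * q) ·I M ≡ u ·I (q ·I M)
·I-assoc u q []            = refl
·I-assoc u q ((r , A) ∷ M) = cong₂ _∷_ (cong (_, A) (*-assoc u q r)) (·I-assoc u q M)

1/p*[p*q]≡q : ∀ p .{{_ : NonZero p}} q → (1/ p) * (p * q) ≡ q
1/p*[p*q]≡q p q = begin
  (1/ p) * (p * q)  ≡⟨ sym (*-assoc (1/ p) p q) ⟩
  ((1/ p) * p) * q  ≡⟨ cong (_* q) (*-inverseˡ p) ⟩
  1ℚ * q            ≡⟨ *-identityˡ q ⟩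
  q                 ∎

·I-inverse : ∀ q .{{_ : NonZero q}} M → (1/ q) ·I (q ·I M) ≡ M
·I-inverse q []            = refl
·I-inverse q ((r , A) ∷ M) = cong₂ _∷_ (cong (_, A) (1/p*[p*q]≡q q r)) (·I-inverse q M)

·I-resp-≈I* : ∀ u {M N} → M ≈I* N → (u ·I M) ≈I* (u ·I N)
·I-resp-≈I* u []      = []
·I-resp-≈I* u (A ∷ r) = A ∷ ·I-resp-≈I* u r

·I-resp-≈I : ∀ u {M N} → M ≈I N → (u ·I M) ≈I (u ·I N)
·I-resp-≈I u (≈I-intro π r) = ≈I-intro (map⁺ _ π) (·I-resp-≈I* u r)

·C-singleton : ∀ u x M y → ⟪ x ∶ u ·I M ⟫ y ≡ (u ·C ⟪ x ∶ M ⟫) y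
·C-singleton u x M y with x ≡ᵇ y
... | true  = refl
... | false = refl

·C-⊎-·C : ∀ u q Γ Δ y → (((u * q) ·C Γ) ⊎ (u ·C Δ)) y ≡ (u ·C ((q ·C Γ) ⊎ Δ)) y
·C-⊎-·C u q Γ Δ y = begin
  (u * q) ·I Γ y ++ u ·I Δ y      ≡⟨ cong (_++ u ·I Δ y) (·I-assoc u q (Γ y)) ⟩
  u ·I (q ·I Γ y) ++ u ·I Δ y     ≡⟨ sym (map-++ _ (q ·I Γ y) (Δ y)) ⟩
  u ·I (q ·I Γ y ++ Δ y)          ∎

ScalableBy : ℚ → IType → Set
ScalableBy u M = All (λ e → u * proj₁ e ≤ 1ℚ) M

ScalableBy-resp-≈I* : ∀ u {M N} → M ≈I* N → ScalableBy u N → ScalableBy u M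
ScalableBy-resp-≈I* u []      []       = []
ScalableBy-resp-≈I* u (_ ∷ r) (s ∷ ss) = s ∷ ScalableBy-resp-≈I* u r ss

ScalableBy-resp-≈I : ∀ u {M N} → M ≈I N → ScalableBy u N → ScalableBy u M
ScalableBy-resp-≈I u (≈I-intro π r) s = All-resp-↭ (↭-sym π) (ScalableBy-resp-≈I* u r s)

wf-scalableBy : ∀ {u M} → 0ℚ ≤ u → u ≤ 1ℚ → WFI M → ScalableBy u M
wf-scalableBy     0≤u u≤1 wfI[]                  = []
wf-scalableBy {u} 0≤u u≤1 (wfI∷ {r} _ r≤1 _ wfM) =
  ≤-trans (subst (u * r ≤_) (*-identityʳ u) (*-monoˡ-≤-nonNeg u {{nonNegative 0≤u}} r≤1)) u≤1
  ∷ wf-scalableBy 0≤u u≤1 wfM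

wf-scalableBy-inverse : ∀ q .{{_ : NonZero q}} {M} → WFI M → ScalableBy (1/ q) (q ·I M)
wf-scalableBy-inverse q wfI[]                  = []
wf-scalableBy-inverse q (wfI∷ {r} _ r≤1 _ wfM) =
  subst (_≤ 1ℚ) (sym (1/p*[p*q]≡q q r)) r≤1
  ∷ wf-scalableBy-inverse q wfM

WFI-scale : ∀ {u M} → 0ℚ < u → ScalableBy u M → WFI M → WFI (u ·I M)
WFI-scale 0<u []       wfI[]                  = wfI[]
WFI-scale 0<u (s ∷ ss) (wfI∷ 0<r _ wfA wfM) = wfI∷ (*-pos 0<u 0<r) s wfA (WFI-scale 0<u ss wfM)

module Rescale (u : ℚ) (0<u : 0ℚ < u) where

  Bang-scale : ∀ {Γ w V N} → Bang Γ w V N → ScalableBy u N →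
               Σ Ctx λ Γ' → Γ' ≗ (u ·C Γ) × Bang Γ' (u * w) V (u ·I N)
  Bang-scale bang[] [] = ∅ , (λ _ → refl) , subst (λ w → Bang ∅ w _ []) (sym (*-zeroʳ u)) bang[]
  Bang-scale (bang∷ {Γ} {Δ} {w} {v} {q = q} 0<q _ ⊢A bs) (s ∷ ss) with Bang-scale bs ss
  ... | Δ' , Δ'≗uΔ , bs' =
    ((u * q) ·C Γ) ⊎ Δ' ,
    (λ y → trans (cong ((u * q) ·I Γ y ++_) (Δ'≗uΔ y)) (·C-⊎-·C u q Γ Δ y)) ,
    subst (λ w' → Bang _ w' _ _) weight (bang∷ (*-pos 0<u 0<q) s ⊢A bs')
    where
    weight : (u * q) * w + u * v ≡ u * (q * w + v)
    weight = trans (cong (_+ u * v) (*-assoc u q w)) (sym (*-distribˡ-+ u (q * w) v))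

  ⊢I-scale : ∀ {Γ w V N} → Γ ⊢I[ w ] V ∶ N → ScalableBy u N → (u ·C Γ) ⊢I[ u * w ] V ∶ (u ·I N)
  ⊢I-scale (⊢var {x} {N} wfN) s =
    subst (λ w → (u ·C ⟪ x ∶ N ⟫) ⊢I[ w ] var x ∶ (u ·I N)) (sym (*-zeroʳ u))
      (convI (⊢var (WFI-scale 0<u s wfN)) (λ y → ≡⇒≈I (·C-singleton u x N y)) (≈I-refl _))
  ⊢I-scale (⊢! bs) s with Bang-scale bs s
  ... | Γ' , Γ'≗uΓ , bs' = convI (⊢! bs') (λ y → ≡⇒≈I (Γ'≗uΓ y)) (≈I-refl _)
  ⊢I-scale (convI ⊢V Γ≈Γ' M≈M') s =
    convI (⊢I-scale ⊢V (ScalableBy-resp-≈I u M≈M' s))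
          (λ y → ·I-resp-≈I u (Γ≈Γ' y)) (·I-resp-≈I u M≈M')

mainTheorem3 : (q : ℚ) → 0ℚ < q → q ≤ 1ℚ →
    (V : Value) (M : IType) (v : ℚ) → WFI M →
    (∅ ⊢I[ q * v ] V ∶ (q ·I M)) ⇔ (∅ ⊢I[ v ] V ∶ M)
mainTheorem3 q 0<q q≤1 V M v wfM = mk⇔ unscale scale
  where
  -- Both directions use that u ·C ∅ computes to ∅.
  instance
    q≢0 : NonZero q
    q≢0 = pos⇒nonZero q {{positive 0<q}}

  0<1/q : 0ℚ < 1/ q
  0<1/q = positive⁻¹ (1/ q) {{1/pos⇒pos q {{positive 0<q}}}}

  scale : ∅ ⊢I[ v ] V ∶ M → ∅ ⊢I[ q * v ] V ∶ (q ·I M)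
  scale ⊢V = Rescale.⊢I-scale q 0<q ⊢V (wf-scalableBy (<⇒≤ 0<q) q≤1 wfM)

  unscale : ∅ ⊢I[ q * v ] V ∶ (q ·I M) → ∅ ⊢I[ v ] V ∶ M
  unscale ⊢V = subst₂ (λ w N → ∅ ⊢I[ w ] V ∶ N) (1/p*[p*q]≡q q v) (·I-inverse q M)
    (Rescale.⊢I-scale (1/ q) 0<1/q ⊢V (wf-scalableBy-inverse q wfM))
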